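{- Let $X$ be a nonempty finite set and let $(X,P)$ be a poset. Then $\dim(X,P)=n$ if and only if $P$ is $n$-fold. More precisely: A. If $\dim(X,P)=n$, then $P$ is at most $n$-fold (that is, there exists a sequence of recursive partial-conjugates $P_1,\dots,P_m$ with $P_1=P$ and $m\le n$); B. If $P$ is $n$-fold, then $\dim(X,P)\le n$.
   Context: A partial order on a finite nonempty set $X$ is a reflexive, antisymmetric, transitive binary relation on $X$; a linear order is a complete partial order. A poset is a pair $(X,P)$ with $P$ a partial order on $X$. Two elements $x,y$ are ordered (comparable) in $P$ if $xPy$ or $yPx$. The dual $P^d$ of $P$ is defined by $xP^dy$ iff $yPx$. For a binary relation $R$, $T_R$ denotes its transitive closure: $xT_Ry$ iff there are $K\ge1$ and $x_1,\dots,x_K$ with $xRx_1Rx_2\cdots Rx_K=y$. The dimension $\dim(X,P)$ is the smallest number of linear orders on $X$ whose intersection is $P$. Conjugate: two partial orders $P,Q$ on the same set $X$ are conjugate if every two distinct elements of $X$ are ordered in exactly one of $P$, $Q$. Partial-conjugate: for partial orders $P,Q$ on $X$, $Q$ is a partial-conjugate of $P$ if (i) every two distinct elements of $X$ are ordered in at most one of $P$, $Q$; (ii) $P\cup Q$ is a partial order; (iii) $T_{P\cup Q^d}$ is a partial order. Sequence of recursive partial-conjugates: partial orders $P_1,\dots,P_n$ on $X$ form such a sequence if (i) for every $k$ with $2\le k\le n-1$, $P_k$ is a partial-conjugate of $\bigcup_{i=1}^{k-1}P_i$; (ii) $P_n$ is a conjugate of $\bigcup_{i=1}^{n-1}P_i$.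 $n$-fold: a partial order $P$ is $n$-fold if $n$ is the smallest integer such that there exists a sequence of recursive partial-conjugates $P_1,\dots,P_n$ with $P_1=P$. -}

module Defs where

open import Data.Nat using (ℕ; zero; suc; _≤_; _<_)
open import Data.Fin using (Fin; toℕ; fromℕ; zero)
open import Data.Bool using (Bool; true)
open import Data.Product using (Σ; Σ-syntax; _×_; _,_)
open import Data.Sum using (_⊎_)
open import Data.Empty using (⊥)
open import Relation.Nullary using (¬_)
open import Relation.Binary.PropositionalEquality using (_≡_; _≢_)
open import Relation.Binary.Construct.Closure.Transitive using (TransClosure)
open import Function using (flip; _⇔_)

-- Relations on the finite set X = Fin N.  Concrete (decidable) relations are
-- Bool-valued; propositions about relations are stated for Set-valued ones.
BRel : ℕ → Set
BRel N = Fin N → Fin N → Bool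

SRel : ℕ → Set₁
SRel N = Fin N → Fin N → Set

⟦_⟧ : ∀ {N} → BRel N → SRel N
⟦ R ⟧ x y = R x y ≡ true

record IsPO {N : ℕ} (R : SRel N) : Set where
  field
    refl  : ∀ x → R x x
    antisym : ∀ {x y} → R x y → R y x → x ≡ y
    trans : ∀ {x y z} → R x y → R y z → R x z

IsLinear : ∀ {N} → SRel N → Set
IsLinear R = IsPO R × (∀ x y → R x y ⊎ R y x)

Ordered : ∀ {N} → SRel N → Fin N → Fin N → Set
Ordered R x y = R x y ⊎ R y x

_∪_ : ∀ {N} → SRel N → SRel N → SRel N
(R ∪ S) x y = R x y ⊎ S x y

_ᵈ : ∀ {N} → SRel N → SRel N
R ᵈ = flip R

T : ∀ {N} → SRel N → SRel N
T R = TransClosure R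

Conj : ∀ {N} → SRel N → SRel N → Set
Conj P Q = ∀ x y → x ≢ y →
  (Ordered P x y ⊎ Ordered Q x y) × ¬ (Ordered P x y × Ordered Q x y)

PartialConj : ∀ {N} → SRel N → SRel N → Set
PartialConj P Q =
  (∀ x y → x ≢ y → ¬ (Ordered P x y × Ordered Q x y))
  × IsPO (P ∪ Q)
  × IsPO (T (P ∪ (Q ᵈ)))

-- union of the first k members (0-based indices < k) of a family
UnionBelow : ∀ {N m} → (Fin m → BRel N) → ℕ → SRel N
UnionBelow {m = m} Ps k x y = Σ[ i ∈ Fin m ] (toℕ i < k × ⟦ Ps i ⟧ x y)

-- a sequence of recursive partial-conjugates P_1,...,P_m of partial orders
-- with P_1 = P (here 0-indexed: Ps 0 = P, length m = suc m')
record RecSeq {N : ℕ} (P : BRel N) (m' : ℕ) : Set where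
  field
    Ps     : Fin (suc m') → BRel N
    allPO  : ∀ i → IsPO ⟦ Ps i ⟧
    first  : ∀ x y → Ps zero x y ≡ P x y
    middle : ∀ (j : Fin (suc m')) → 1 ≤ toℕ j → toℕ j < m' →
             PartialConj (UnionBelow Ps (toℕ j)) ⟦ Ps j ⟧
    last   : Conj (UnionBelow Ps m') ⟦ Ps (fromℕ m') ⟧

HasSeq : ∀ {N} → BRel N → ℕ → Set
HasSeq P zero = ⊥
HasSeq P (suc m') = RecSeq P m'

NFold : ∀ {N} → BRel N → ℕ → Set
NFold P n = HasSeq P n × (∀ m → HasSeq P m → n ≤ m)

HasRealizer : ∀ {N} → BRel N → ℕ → Set
HasRealizer {N} P k = 1 ≤ k × Σ[ L ∈ (Fin k → BRel N) ]
  ((∀ i → IsLinear ⟦ L i ⟧) × (∀ x y → ⟦ P ⟧ x y ⇔ (∀ i → ⟦ L i ⟧ x y)))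

Dim : ∀ {N} → BRel N → ℕ → Set
Dim P n = HasRealizer P n × (∀ k → HasRealizer P k → n ≤ k)

-- Given a sequence P₁, …, Pₙ,
-- take a linear extension of P₁ ∪ ⋯ ∪ Pₙ and, for every k ≥ 2, a linear
-- extension of T((P₁ ∪ ⋯ ∪ Pₖ₋₁) ∪ Pₖᵈ).  If x precedes y in all of these
-- orders, then P₁ ∪ ⋯ ∪ Pₙ, which relates any two points because Pₙ is a
-- conjugate, relates x to y; and no Pₖ with k ≥ 2 can be responsible for it,
-- so x P₁ y.  Conversely, given a realizer L₁, …, Lₙ of P, let Pₖ₊₁ consist
-- of the pairs on which Lₖ₊₁, …, Lₙ agree and Lₖ disagrees.  Then
-- P₁ ∪ ⋯ ∪ Pₖ is exactly Lₖ ∩ ⋯ ∩ Lₙ, which makes each Pₖ₊₁ a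
-- partial-conjugate of the previous union and Pₙ a conjugate of it.

module Submission where

open import Defs
open import Data.Nat as ℕ using (ℕ; zero; suc; _≤_; _<_; z≤n; s≤s)
import Data.Nat.Properties as ℕ
open import Data.Fin as Fin using (Fin; zero; suc; toℕ; fromℕ; fromℕ<; inject₁; combine)
import Data.Fin.Properties as Fin
open import Data.Fin.Properties
  using (toℕ-injective; toℕ-fromℕ; toℕ-fromℕ<; toℕ-inject₁; toℕ<n; any?; all?)
open import Data.Fin.Subset using (Subset; _∈_; _⊆_; _⊂_; ∣_∣; ⁅_⁆) renaming (_∪_ to _∪ₛ_)
open import Data.Fin.Subset.Properties
  using (_∈?_; _⊂?_; p⊂q⇒∣p∣<∣q∣; ∣p∣≤n; p⊆p∪q; x∈p∪q⁺; x∈p∪q⁻; x∈⁅x⁆; x∈⁅y⁆⇒x≡y)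
open import Data.Vec using (tabulate)
open import Data.Vec.Properties using (lookup∘tabulate; lookup⇒[]=; []=⇒lookup)
open import Data.Bool as Bool using (true)
open import Data.Empty using (⊥; ⊥-elim)
open import Data.Product using (Σ-syntax; ∃-syntax; _×_; _,_; proj₁; proj₂)
open import Data.Sum as Sum using (_⊎_; inj₁; inj₂)
open import Function using (_⇔_; mk⇔; Equivalence)
open import Relation.Binary.Core using (_⇒_) renaming (_⇔_ to _⇔₂_)
open import Relation.Binary.Definitions using (Decidable; Transitive; Reflexive)
open import Relation.Binary.PropositionalEquality
  using (_≡_; _≢_; refl; sym; trans; subst; subst₂)
open import Relation.Binary.Construct.Closure.Transitive using ([_]; _∷_; _∷ʳ_; _++_)
open import Relation.Nullary using (¬_; Dec; yes; no; does)
open import Relation.Nullary.Decidable using (dec-true; map′; decidable-stable; _×-dec_; _⊎-dec_; _→-dec_; ¬?)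

private
  variable
    n : ℕ
    x y z : Fin n
    R S R′ S′ : SRel n

witness : ∀ {A : Set} (a? : Dec A) → does a? ≡ true → A
witness (yes a) _ = a

⌊_⌋₂ : {R : SRel n} → Decidable R → BRel n
⌊ R? ⌋₂ x y = does (R? x y)

⌊⌋₂-⇔ : (R? : Decidable R) → ⟦ ⌊ R? ⌋₂ ⟧ ⇔₂ R
⌊⌋₂-⇔ R? = witness (R? _ _) , dec-true (R? _ _)

⟦⟧-dec : (B : BRel n) → Decidable ⟦ B ⟧
⟦⟧-dec B x y = B x y Bool.≟ true

∪-dec : Decidable R → Decidable S → Decidable (R ∪ S)
∪-dec R? S? x y = R? x y ⊎-dec S? x y

ᵈ-dec : Decidable R → Decidable (R ᵈ)
ᵈ-dec R? x y = R? y x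

toℕ-onto : ∀ {a m} → a < m → Σ[ i ∈ Fin m ] a ≡ toℕ i
toℕ-onto a<m = fromℕ< a<m , sym (toℕ-fromℕ< a<m)

⇔₂-sym : R ⇔₂ S → S ⇔₂ R
⇔₂-sym (R⇒S , S⇒R) = S⇒R , R⇒S

⇔₂-trans : R ⇔₂ S → S ⇔₂ S′ → R ⇔₂ S′
⇔₂-trans (R⇒S , S⇒R) (S⇒S′ , S′⇒S) = (λ r → S⇒S′ (R⇒S r)) , (λ s′ → S⇒R (S′⇒S s′))

∪-cong : R ⇔₂ R′ → S ⇔₂ S′ → (R ∪ S) ⇔₂ (R′ ∪ S′)
∪-cong (R⇒R′ , R′⇒R) (S⇒S′ , S′⇒S) = Sum.map R⇒R′ S⇒S′ , Sum.map R′⇒R S′⇒S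

ᵈ-cong : R ⇔₂ S → (R ᵈ) ⇔₂ (S ᵈ)
ᵈ-cong (R⇒S , S⇒R) = R⇒S , S⇒R

Ordered-map : R ⇒ S → ∀ x y → Ordered R x y → Ordered S x y
Ordered-map R⇒S _ _ = Sum.map R⇒S R⇒S

isPO-resp : R ⇔₂ S → IsPO R → IsPO S
isPO-resp (R⇒S , S⇒R) po = record
  { refl    = λ x → R⇒S (IsPO.refl po x)
  ; antisym = λ p q → IsPO.antisym po (S⇒R p) (S⇒R q)
  ; trans   = λ p q → R⇒S (IsPO.trans po (S⇒R p) (S⇒R q))
  }

isLinear-resp : R ⇔₂ S → IsLinear R → IsLinear S
isLinear-resp R⇔S (po , total) =
  isPO-resp R⇔S po , λ x y → Ordered-map (proj₁ R⇔S) x y (total x y)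

isPO-ᵈ : IsPO R → IsPO (R ᵈ)
isPO-ᵈ po = record
  { refl    = IsPO.refl po
  ; antisym = λ p q → IsPO.antisym po q p
  ; trans   = λ p q → IsPO.trans po q p
  }

T-least : Transitive S → R ⇒ S → T R ⇒ S
T-least S-trans R⇒S [ r ]    = R⇒S r
T-least S-trans R⇒S (r ∷ rs) = S-trans (R⇒S r) (T-least S-trans R⇒S rs)

T-cong : R ⇔₂ S → T R ⇔₂ T S
T-cong (R⇒S , S⇒R) = T-least _++_ (λ r → [ R⇒S r ]) , T-least _++_ (λ s → [ S⇒R s ])

T-isPO-⊆ : Reflexive R → IsPO S → R ⇒ S → IsPO (T R)
T-isPO-⊆ {R = R} {S = S} R-refl S-po R⇒S = record
  { refl    = λ x → [ R-refl ]
  ; antisym = λ p q → IsPO.antisym S-po (below p) (below q)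
  ; trans   = _++_
  }
  where
  below : T R ⇒ S
  below = T-least (IsPO.trans S-po) R⇒S

T-isPO : IsPO R → IsPO (T R)
T-isPO po = T-isPO-⊆ (IsPO.refl po _) po (λ r → r)

-- Conjugate partial orders

conj-both : Conj R S → Ordered R x y → Ordered S x y → x ≡ y
conj-both {x = x} {y} c r s with x Fin.≟ y
... | yes x≡y = x≡y
... | no x≢y  = ⊥-elim (proj₂ (c x y x≢y) (r , s))

Conj-swap : Conj R S → Conj S R
Conj-swap c x y x≢y = Sum.swap (proj₁ (c x y x≢y)) , λ (s , r) → proj₂ (c x y x≢y) (r , s)

Conj-ᵈ : Conj R S → Conj R (S ᵈ)
Conj-ᵈ c x y x≢y =
  Sum.map₂ Sum.swap (proj₁ (c x y x≢y)) , λ (r , s) → proj₂ (c x y x≢y) (r , Sum.swap s)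

Conj-resp : R ⇔₂ R′ → S ⇔₂ S′ → Conj R S → Conj R′ S′
Conj-resp (R⇒R′ , R′⇒R) (S⇒S′ , S′⇒S) c x y x≢y =
  Sum.map (Ordered-map R⇒R′ x y) (Ordered-map S⇒S′ x y) (proj₁ (c x y x≢y)) ,
  λ (r , s) → proj₂ (c x y x≢y) (Ordered-map R′⇒R x y r , Ordered-map S′⇒S x y s)

PartialConj-resp : R ⇔₂ R′ → S ⇔₂ S′ → PartialConj R S → PartialConj R′ S′
PartialConj-resp R⇔R′@(_ , R′⇒R) S⇔S′@(_ , S′⇒S) (disjoint , ∪-po , T-po) =
  (λ x y x≢y (r , s) → disjoint x y x≢y (Ordered-map R′⇒R x y r , Ordered-map S′⇒S x y s)) ,
  isPO-resp (∪-cong R⇔R′ S⇔S′) ∪-po ,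
  isPO-resp (T-cong (∪-cong R⇔R′ (ᵈ-cong S⇔S′))) T-po

private
  conj-mixed-trans : IsPO R → IsPO S → Conj R S → R x y → S y z → (R ∪ S) x z
  conj-mixed-trans {x = x} {z = z} R-po S-po c Rxy Syz with x Fin.≟ z
  ... | yes refl = inj₁ (IsPO.refl R-po x)
  ... | no x≢z with proj₁ (c x z x≢z)
  ... | inj₁ (inj₁ Rxz) = inj₁ Rxz
  ... | inj₂ (inj₁ Sxz) = inj₂ Sxz
  ... | inj₁ (inj₂ Rzx) with refl ← conj-both c (inj₂ (IsPO.trans R-po Rzx Rxy)) (inj₁ Syz) = inj₁ Rxy
  ... | inj₂ (inj₂ Szx) with refl ← conj-both c (inj₁ Rxy) (inj₂ (IsPO.trans S-po Syz Szx)) = inj₂ Syz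

∪-isPO : IsPO R → IsPO S → Conj R S → IsPO (R ∪ S)
∪-isPO {R = R} {S = S} R-po S-po c = record
  { refl = λ x → inj₁ (IsPO.refl R-po x) ; antisym = antisym ; trans = trans′ }
  where
  antisym : (R ∪ S) x y → (R ∪ S) y x → x ≡ y
  antisym (inj₁ p) (inj₁ q) = IsPO.antisym R-po p q
  antisym (inj₂ p) (inj₂ q) = IsPO.antisym S-po p q
  antisym (inj₁ p) (inj₂ q) = conj-both c (inj₁ p) (inj₂ q)
  antisym (inj₂ p) (inj₁ q) = conj-both c (inj₂ q) (inj₁ p)

  trans′ : (R ∪ S) x y → (R ∪ S) y z → (R ∪ S) x z
  trans′ (inj₁ p) (inj₁ q) = inj₁ (IsPO.trans R-po p q)
  trans′ (inj₂ p) (inj₂ q) = inj₂ (IsPO.trans S-po p q)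
  trans′ (inj₁ p) (inj₂ q) = conj-mixed-trans R-po S-po c p q
  trans′ (inj₂ p) (inj₁ q) = Sum.swap (conj-mixed-trans S-po R-po (Conj-swap c) p q)

fromPred : {A : Fin n → Set} → (∀ y → Dec (A y)) → Subset n
fromPred A? = tabulate λ y → does (A? y)

∈fromPred⁺ : {A : Fin n → Set} (A? : ∀ y → Dec (A y)) → A y → y ∈ fromPred A?
∈fromPred⁺ {y = y} A? a = lookup⇒[]= y _ (trans (lookup∘tabulate _ y) (dec-true (A? y) a))

∈fromPred⁻ : {A : Fin n → Set} (A? : ∀ y → Dec (A y)) → y ∈ fromPred A? → A y
∈fromPred⁻ {y = y} A? y∈ = witness (A? y) (trans (sym (lookup∘tabulate _ y)) ([]=⇒lookup y∈))

-- Decidability of the transitive closure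

-- The sets of points reachable from x in at most k + 1 steps grow until
-- they are closed under successors, and every strict growth increases
-- their size; so they are closed after n + 1 rounds.
module Reachability {R : SRel n} (R? : Decidable R) where

  HasPredecessorIn? : (A : Subset n) → ∀ y → Dec (∃[ z ] (z ∈ A × R z y))
  HasPredecessorIn? A y = any? λ z → z ∈? A ×-dec R? z y

  successors : Subset n → Subset n
  successors A = fromPred (HasPredecessorIn? A)

  ∈successors⁺ : {A : Subset n} → z ∈ A → R z y → y ∈ successors A
  ∈successors⁺ {z = z} {A = A} z∈A zRy = ∈fromPred⁺ (HasPredecessorIn? A) (z , z∈A , zRy)

  ∈successors⁻ : {A : Subset n} → y ∈ successors A → ∃[ z ] (z ∈ A × R z y)
  ∈successors⁻ {A = A} = ∈fromPred⁻ (HasPredecessorIn? A)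

  successors-mono : {A B : Subset n} → A ⊆ B → successors A ⊆ successors B
  successors-mono A⊆B y∈ with z , z∈A , zRy ← ∈successors⁻ y∈ = ∈successors⁺ (A⊆B z∈A) zRy

  Closed : Subset n → Set
  Closed A = successors A ⊆ A

  reach : Fin n → ℕ → Subset n
  reach x zero    = successors ⁅ x ⁆
  reach x (suc k) = reach x k ∪ₛ successors (reach x k)

  reach-sound : ∀ k → y ∈ reach x k → T R x y
  reach-sound {x = x} zero y∈
    with z , z∈⁅x⁆ , zRy ← ∈successors⁻ y∈ with refl ← x∈⁅y⁆⇒x≡y x z∈⁅x⁆ = [ zRy ]
  reach-sound (suc k) y∈ with x∈p∪q⁻ _ _ y∈
  ... | inj₁ y∈reach = reach-sound k y∈reach
  ... | inj₂ y∈succ with z , z∈ , zRy ← ∈successors⁻ y∈succ = reach-sound k z∈ ∷ʳ zRy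

  reach-first : ∀ k → reach x 0 ⊆ reach x k
  reach-first zero    y∈ = y∈
  reach-first (suc k) y∈ = p⊆p∪q _ (reach-first k y∈)

  closed-step : {A : Subset n} → Closed A → Closed (A ∪ₛ successors A)
  closed-step closed y∈ =
    p⊆p∪q _ (closed (successors-mono (λ z∈ → Sum.[ (λ z∈A → z∈A) , closed ] (x∈p∪q⁻ _ _ z∈)) y∈))

  closed-or-grows : (A : Subset n) → Closed A ⊎ A ⊂ A ∪ₛ successors A
  closed-or-grows A with A ⊂? (A ∪ₛ successors A)
  ... | yes A⊂ = inj₂ A⊂
  ... | no ¬A⊂ = inj₁ λ {y} y∈succ → decidable-stable (y ∈? A)
          λ y∉A → ¬A⊂ (p⊆p∪q _ , y , x∈p∪q⁺ (inj₂ y∈succ) , y∉A)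

  closed-or-large : ∀ k → Closed (reach x k) ⊎ k ≤ ∣ reach x k ∣
  closed-or-large zero = inj₂ z≤n
  closed-or-large {x = x} (suc k) with closed-or-large k
  ... | inj₁ closed = inj₁ (closed-step closed)
  ... | inj₂ k≤ with closed-or-grows (reach x k)
  ...   | inj₁ closed = inj₁ (closed-step closed)
  ...   | inj₂ grows  = inj₂ (ℕ.≤-<-trans k≤ (p⊂q⇒∣p∣<∣q∣ grows))

  reach-closed : Closed (reach x (suc n))
  reach-closed {x = x} with closed-or-large {x = x} (suc n)
  ... | inj₁ closed = closed
  ... | inj₂ large  = ⊥-elim (ℕ.n≮n n (ℕ.≤-trans large (∣p∣≤n (reach x (suc n)))))

  closed-⊇T : {A : Subset n} → Closed A → z ∈ A → T R z y → y ∈ A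
  closed-⊇T closed z∈ [ zRy ]       = closed (∈successors⁺ z∈ zRy)
  closed-⊇T closed z∈ (zRw ∷ w⁺y) = closed-⊇T closed (closed (∈successors⁺ z∈ zRw)) w⁺y

  reach-complete : T R x y → y ∈ reach x (suc n)
  reach-complete {x = x} [ xRy ]       = reach-first (suc n) (∈successors⁺ (x∈⁅x⁆ x) xRy)
  reach-complete {x = x} (xRz ∷ z⁺y) =
    closed-⊇T reach-closed (reach-first (suc n) (∈successors⁺ (x∈⁅x⁆ x) xRz)) z⁺y

T-dec : {R : SRel n} → Decidable R → Decidable (T R)
T-dec {n = n} R? x y = map′ (reach-sound (suc n)) reach-complete (y ∈? reach x (suc n))
  where open Reachability R?

-- Linear extensions

-- Order the points by the size of their down-sets, breaking ties by index:
-- a strict step of R strictly enlarges the down-set.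
module LinearExtension {R : SRel n} (po : IsPO R) (R? : Decidable R) where

  downset : Fin n → Subset n
  downset y = fromPred λ z → R? z y

  downset-⊂ : R x y → x ≢ y → downset x ⊂ downset y
  downset-⊂ {x} {y} xRy x≢y =
    (λ z∈ → ∈fromPred⁺ (λ z → R? z y) (IsPO.trans po (∈fromPred⁻ (λ z → R? z x) z∈) xRy)) ,
    y , ∈fromPred⁺ (λ z → R? z y) (IsPO.refl po y) ,
    λ y∈ → x≢y (IsPO.antisym po xRy (∈fromPred⁻ (λ z → R? z x) y∈))

  rank : Fin n → Fin (suc n)
  rank y = fromℕ< (s≤s (∣p∣≤n (downset y)))

  rank-< : R x y → x ≢ y → rank x Fin.< rank y
  rank-< xRy x≢y = subst₂ _<_ (sym (toℕ-fromℕ< _)) (sym (toℕ-fromℕ< _))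
                          (p⊂q⇒∣p∣<∣q∣ (downset-⊂ xRy x≢y))

  key : Fin n → Fin (suc n ℕ.* n)
  key y = combine (rank y) y

  Precedes : SRel n
  Precedes x y = key x Fin.≤ key y

  Precedes-isLinear : IsLinear Precedes
  Precedes-isLinear =
    record
      { refl    = λ x → Fin.≤-refl
      ; antisym = λ {x} {y} p q → Fin.combine-injectiveʳ (rank x) x (rank y) y (Fin.≤-antisym p q)
      ; trans   = λ p q → Fin.≤-trans p q
      } ,
    λ x y → Fin.≤-total (key x) (key y)

  R⇒Precedes : R ⇒ Precedes
  R⇒Precedes {x} {y} xRy with x Fin.≟ y
  ... | yes refl = Fin.≤-refl
  ... | no x≢y   = ℕ.<⇒≤ (Fin.combine-monoˡ-< x y (rank-< xRy x≢y))

linearExtension : IsPO R → Decidable R → Σ[ L ∈ BRel n ] (IsLinear ⟦ L ⟧ × R ⇒ ⟦ L ⟧)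
linearExtension po R? =
  ⌊ Precedes? ⌋₂ ,
  isLinear-resp (⇔₂-sym (⌊⌋₂-⇔ Precedes?)) Precedes-isLinear ,
  λ r → proj₂ (⌊⌋₂-⇔ Precedes?) (R⇒Precedes r)
  where
  open LinearExtension po R?
  Precedes? : Decidable Precedes
  Precedes? x y = key x Fin.≤? key y

module _ {m : ℕ} (Ps : Fin m → BRel n) where

  UnionBelow-dec : ∀ k → Decidable (UnionBelow Ps k)
  UnionBelow-dec k x y = any? λ i → (toℕ i ℕ.<? k) ×-dec ⟦⟧-dec (Ps i) x y

  UnionBelow-suc : ∀ (j : Fin m) {k} → toℕ j ≡ k →
                   UnionBelow Ps (suc k) ⇔₂ (UnionBelow Ps k ∪ ⟦ Ps j ⟧)
  UnionBelow-suc j refl = split , join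
    where
    split : UnionBelow Ps (suc (toℕ j)) ⇒ (UnionBelow Ps (toℕ j) ∪ ⟦ Ps j ⟧)
    split (i , s≤s i≤j , p) with ℕ.m≤n⇒m<n∨m≡n i≤j
    ... | inj₁ i<j = inj₁ (i , i<j , p)
    ... | inj₂ i≡j with refl ← toℕ-injective i≡j = inj₂ p

    join : (UnionBelow Ps (toℕ j) ∪ ⟦ Ps j ⟧) ⇒ UnionBelow Ps (suc (toℕ j))
    join (inj₁ (i , i<j , p)) = i , ℕ.m≤n⇒m≤1+n i<j , p
    join (inj₂ p)             = j , ℕ.≤-refl , p

  UnionBelow-mono : ∀ {k l} → k ≤ l → UnionBelow Ps k ⇒ UnionBelow Ps l
  UnionBelow-mono k≤l (i , i<k , p) = i , ℕ.≤-trans i<k k≤l , p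

  UnionBelow-first : (∀ j → 1 ≤ toℕ j → ¬ ⟦ Ps j ⟧ x y) →
                     ∀ k → UnionBelow Ps k x y → UnionBelow Ps 1 x y
  UnionBelow-first later zero (_ , () , _)
  UnionBelow-first later (suc zero) u = u
  UnionBelow-first later (suc (suc k)) (i , s≤s i≤1+k , p) = Sum.[
      (λ i<1+k → UnionBelow-first later (suc k) (i , i<1+k , p)) ,
      (λ i≡1+k → ⊥-elim (later i (subst (1 ≤_) (sym i≡1+k) (s≤s z≤n)) p)) ]
    (ℕ.m≤n⇒m<n∨m≡n i≤1+k)

UnionBelow-1 : ∀ {m} (Ps : Fin (suc m) → BRel n) → UnionBelow Ps 1 ⇔₂ ⟦ Ps zero ⟧
UnionBelow-1 Ps = (λ { (zero , _ , p) → p ; (suc _ , s≤s () , _) }) , λ p → zero , s≤s z≤n , p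

-- From a sequence of recursive partial-conjugates to a realizer

module FromSequence {P : BRel n} {m′ : ℕ} (seq : RecSeq P m′) where
  open RecSeq seq

  U : ℕ → SRel n
  U = UnionBelow Ps

  Ps₀⇔P : ⟦ Ps zero ⟧ ⇔₂ ⟦ P ⟧
  Ps₀⇔P = (λ {x} {y} p → trans (sym (first x y)) p) , (λ {x} {y} p → trans (first x y) p)

  U₁⇔P : U 1 ⇔₂ ⟦ P ⟧
  U₁⇔P = ⇔₂-trans (UnionBelow-1 Ps) Ps₀⇔P

  P-isPO : IsPO ⟦ P ⟧
  P-isPO = isPO-resp Ps₀⇔P (allPO zero)

  U₁-isPO : IsPO (U 1)
  U₁-isPO = isPO-resp (⇔₂-sym U₁⇔P) P-isPO

  U-isPO-at : ∀ (j : Fin (suc m′)) → toℕ j < m′ → IsPO (U (suc (toℕ j)))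
  U-isPO-at zero    _      = U₁-isPO
  U-isPO-at (suc i) 1+i<m′ =
    isPO-resp (⇔₂-sym (UnionBelow-suc Ps (suc i) refl)) (proj₁ (proj₂ (middle (suc i) (s≤s z≤n) 1+i<m′)))

  U-isPO : ∀ a → a < m′ → IsPO (U (suc a))
  U-isPO a a<m′ with j , refl ← toℕ-onto {m = suc m′} (ℕ.m≤n⇒m≤1+n a<m′) = U-isPO-at j a<m′

  last-at : ∀ (i : Fin m′) → suc (toℕ i) ≡ m′ → Conj (U (suc (toℕ i))) ⟦ Ps (suc i) ⟧
  last-at i 1+i≡m′
    rewrite toℕ-injective {i = suc i} {j = fromℕ m′} (trans 1+i≡m′ (sym (toℕ-fromℕ m′))) | 1+i≡m′ = last

  U-full⇔ : (U m′ ∪ ⟦ Ps (fromℕ m′) ⟧) ⇔₂ U (suc m′)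
  U-full⇔ = ⇔₂-sym (UnionBelow-suc Ps (fromℕ m′) (toℕ-fromℕ m′))

  U-full-isPO : IsPO (U (suc m′))
  U-full-isPO = go m′ refl
    where
    go : ∀ k → k ≡ m′ → IsPO (U (suc k))
    go zero    refl = U₁-isPO
    go (suc k) refl = isPO-resp U-full⇔ (∪-isPO (U-isPO k ℕ.≤-refl) (allPO (fromℕ (suc k))) last)

  U-full-total : x ≢ y → Ordered (U (suc m′)) x y
  U-full-total {x = x} {y} x≢y =
    Sum.[ Ordered-map (λ u → proj₁ U-full⇔ (inj₁ u)) x y ,
          Ordered-map (λ q → proj₁ U-full⇔ (inj₂ q)) x y ]′
      (proj₁ (last x y x≢y))

  Constraint : Fin (suc m′) → SRel n
  Constraint zero    = U (suc m′)
  Constraint (suc i) = T (U (suc (toℕ i)) ∪ (⟦ Ps (suc i) ⟧ ᵈ))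

  Constraint-isPO : ∀ i → IsPO (Constraint i)
  Constraint-isPO zero = U-full-isPO
  Constraint-isPO (suc i) with ℕ.m≤n⇒m<n∨m≡n (toℕ<n i)
  ... | inj₁ 1+i<m′ = proj₂ (proj₂ (middle (suc i) (s≤s z≤n) 1+i<m′))
  ... | inj₂ 1+i≡m′ = T-isPO (∪-isPO (U-isPO (toℕ i) (toℕ<n i)) (isPO-ᵈ (allPO (suc i)))
                                      (Conj-ᵈ (last-at i 1+i≡m′)))

  Constraint-dec : ∀ i → Decidable (Constraint i)
  Constraint-dec zero    = UnionBelow-dec Ps (suc m′)
  Constraint-dec (suc i) = T-dec (∪-dec (UnionBelow-dec Ps _) (ᵈ-dec (⟦⟧-dec (Ps (suc i)))))

  P⇒Constraint : ∀ i → ⟦ P ⟧ ⇒ Constraint i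
  P⇒Constraint zero    p = UnionBelow-mono Ps (s≤s z≤n) (proj₂ U₁⇔P p)
  P⇒Constraint (suc i) p = [ inj₁ (UnionBelow-mono Ps (s≤s z≤n) (proj₂ U₁⇔P p)) ]

  extension : ∀ i → Σ[ L ∈ BRel n ] (IsLinear ⟦ L ⟧ × Constraint i ⇒ ⟦ L ⟧)
  extension i = linearExtension (Constraint-isPO i) (Constraint-dec i)

  order : Fin (suc m′) → BRel n
  order i = proj₁ (extension i)

  order-isLinear : ∀ i → IsLinear ⟦ order i ⟧
  order-isLinear i = proj₁ (proj₂ (extension i))

  Constraint⇒order : ∀ i → Constraint i ⇒ ⟦ order i ⟧
  Constraint⇒order i = proj₂ (proj₂ (extension i))

  order-antisym : ∀ i → ⟦ order i ⟧ x y → ⟦ order i ⟧ y x → x ≡ y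
  order-antisym i = IsPO.antisym (proj₁ (order-isLinear i))

  ⋂order⇒P : (∀ i → ⟦ order i ⟧ x y) → ⟦ P ⟧ x y
  ⋂order⇒P {x = x} {y} x≤y with x Fin.≟ y
  ... | yes refl = IsPO.refl P-isPO x
  ... | no x≢y with U-full-total x≢y
  ... | inj₂ Uyx = ⊥-elim (x≢y (order-antisym zero (x≤y zero) (Constraint⇒order zero Uyx)))
  ... | inj₁ Uxy = proj₁ U₁⇔P (UnionBelow-first Ps unflipped (suc m′) Uxy)
    where
    unflipped : ∀ j → 1 ≤ toℕ j → ¬ ⟦ Ps j ⟧ x y
    unflipped (suc i) _ p =
      x≢y (order-antisym (suc i) (x≤y (suc i)) (Constraint⇒order (suc i) [ inj₂ p ]))

  realizer : HasRealizer P (suc m′)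
  realizer = s≤s z≤n , order , order-isLinear ,
    λ x y → mk⇔ (λ p i → Constraint⇒order i (P⇒Constraint i p)) ⋂order⇒P

-- From a realizer to a sequence of recursive partial-conjugates

module FromRealizer {P : BRel n} {m′ : ℕ} (L : Fin (suc m′) → BRel n)
  (L-isLinear : ∀ i → IsLinear ⟦ L i ⟧) (P⇔⋂L : ∀ x y → ⟦ P ⟧ x y ⇔ (∀ i → ⟦ L i ⟧ x y)) where

  L-isPO : ∀ i → IsPO ⟦ L i ⟧
  L-isPO i = proj₁ (L-isLinear i)

  L-reverse : ∀ i → ¬ ⟦ L i ⟧ x y → ⟦ L i ⟧ y x
  L-reverse {x = x} {y} i ¬xy = Sum.[ (λ xy → ⊥-elim (¬xy xy)) , (λ yx → yx) ] (proj₂ (L-isLinear i) x y)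

  Suffix : ℕ → SRel n
  Suffix a x y = ∀ i → a ≤ toℕ i → ⟦ L i ⟧ x y

  Suffix-dec : ∀ a → Decidable (Suffix a)
  Suffix-dec a x y = all? λ i → (a ℕ.≤? toℕ i) →-dec ⟦⟧-dec (L i) x y

  Suffix-isPO : ∀ {a} → a ≤ m′ → IsPO (Suffix a)
  Suffix-isPO {a} a≤m′ = record
    { refl    = λ x i _ → IsPO.refl (L-isPO i) x
    ; antisym = λ p q → IsPO.antisym (L-isPO (fromℕ m′)) (p _ a≤top) (q _ a≤top)
    ; trans   = λ p q i a≤i → IsPO.trans (L-isPO i) (p i a≤i) (q i a≤i)
    }
    where
    a≤top : a ≤ toℕ (fromℕ m′)
    a≤top = subst (a ≤_) (sym (toℕ-fromℕ m′)) a≤m′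

  Suffix-weaken : ∀ {a c} → a ≤ c → Suffix a ⇒ Suffix c
  Suffix-weaken a≤c s i c≤i = s i (ℕ.≤-trans a≤c c≤i)

  Suffix-at : ∀ (i : Fin m′) → Suffix (toℕ i) ⇒ ⟦ L (inject₁ i) ⟧
  Suffix-at i s = s (inject₁ i) (ℕ.≤-reflexive (sym (toℕ-inject₁ i)))

  Suffix-extend : ∀ (i : Fin m′) → Suffix (suc (toℕ i)) x y → ⟦ L (inject₁ i) ⟧ x y → Suffix (toℕ i) x y
  Suffix-extend i s l k i≤k with ℕ.m≤n⇒m<n∨m≡n i≤k
  ... | inj₁ i<k = s k i<k
  ... | inj₂ i≡k with refl ← toℕ-injective (trans (toℕ-inject₁ i) i≡k) = l

  Suffix-last-total : ∀ {a} → a ≡ m′ → ∀ x y → Ordered (Suffix a) x y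
  Suffix-last-total refl x y = Ordered-map (λ l k m′≤k → subst (λ i → ⟦ L i ⟧ _ _) (sym (is-top k m′≤k)) l)
                                            x y (proj₂ (L-isLinear (fromℕ m′)) x y)
    where
    is-top : ∀ k → m′ ≤ toℕ k → k ≡ fromℕ m′
    is-top k m′≤k = toℕ-injective (trans (ℕ.≤-antisym (ℕ.≤-pred (toℕ<n k)) m′≤k) (sym (toℕ-fromℕ m′)))

  P⇔Suffix₀ : ⟦ P ⟧ ⇔₂ Suffix 0
  P⇔Suffix₀ = (λ {x} {y} p i _ → Equivalence.to (P⇔⋂L x y) p i) ,
              (λ {x} {y} s → Equivalence.from (P⇔⋂L x y) (λ i → s i z≤n))

  Flip : Fin m′ → SRel n
  Flip i x y = x ≡ y ⊎ (Suffix (suc (toℕ i)) x y × ¬ ⟦ L (inject₁ i) ⟧ x y)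

  Flip-dec : ∀ i → Decidable (Flip i)
  Flip-dec i x y = (x Fin.≟ y) ⊎-dec (Suffix-dec _ x y ×-dec ¬? (⟦⟧-dec (L (inject₁ i)) x y))

  Flip-isPO : ∀ i → IsPO (Flip i)
  Flip-isPO i = record { refl = λ _ → inj₁ refl ; antisym = antisym ; trans = trans′ }
    where
    open IsPO (Suffix-isPO (toℕ<n i)) using () renaming (antisym to S-antisym; trans to S-trans)
    ι = inject₁ i

    antisym : Flip i x y → Flip i y x → x ≡ y
    antisym (inj₁ x≡y)     _               = x≡y
    antisym (inj₂ _)       (inj₁ y≡x)      = sym y≡x
    antisym (inj₂ (s , _)) (inj₂ (s′ , _)) = S-antisym s s′

    trans′ : Flip i x y → Flip i y z → Flip i x z
    trans′ (inj₁ refl)     q                = q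
    trans′ (inj₂ p)        (inj₁ refl)      = inj₂ p
    trans′ (inj₂ (s , ¬l)) (inj₂ (s′ , ¬l′)) =
      inj₂ (S-trans s s′ , λ l → ¬l (IsPO.trans (L-isPO ι) l (L-reverse ι ¬l′)))

  Suffix∪Flip : ∀ i → (Suffix (toℕ i) ∪ Flip i) ⇔₂ Suffix (suc (toℕ i))
  Suffix∪Flip i = split , join
    where
    split : (Suffix (toℕ i) ∪ Flip i) ⇒ Suffix (suc (toℕ i))
    split (inj₁ s)               = Suffix-weaken (ℕ.n≤1+n _) s
    split (inj₂ (inj₁ refl))     = IsPO.refl (Suffix-isPO (toℕ<n i)) _
    split (inj₂ (inj₂ (s , _))) = s

    join : Suffix (suc (toℕ i)) ⇒ (Suffix (toℕ i) ∪ Flip i)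
    join {x} {y} s with ⟦⟧-dec (L (inject₁ i)) x y
    ... | yes l = inj₁ (Suffix-extend i s l)
    ... | no ¬l = inj₂ (inj₂ (s , ¬l))

  Flip-disjoint : ∀ i → x ≢ y → Ordered (Suffix (toℕ i)) x y → Ordered (Flip i) x y → ⊥
  Flip-disjoint i x≢y _          (inj₁ (inj₁ x≡y)) = x≢y x≡y
  Flip-disjoint i x≢y _          (inj₂ (inj₁ y≡x)) = x≢y (sym y≡x)
  Flip-disjoint i x≢y (inj₁ sxy) (inj₁ (inj₂ (_ , ¬l))) = ¬l (Suffix-at i sxy)
  Flip-disjoint i x≢y (inj₂ syx) (inj₂ (inj₂ (_ , ¬l))) = ¬l (Suffix-at i syx)
  Flip-disjoint i x≢y (inj₁ sxy) (inj₂ (inj₂ (s , _))) =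
    x≢y (IsPO.antisym (Suffix-isPO (toℕ<n i)) (Suffix-weaken (ℕ.n≤1+n _) sxy) s)
  Flip-disjoint i x≢y (inj₂ syx) (inj₁ (inj₂ (s , _))) =
    x≢y (IsPO.antisym (Suffix-isPO (toℕ<n i)) s (Suffix-weaken (ℕ.n≤1+n _) syx))

  Flip-partialConj : ∀ i → PartialConj (Suffix (toℕ i)) (Flip i)
  Flip-partialConj i =
    (λ x y x≢y (s , f) → Flip-disjoint i x≢y s f) ,
    isPO-resp (⇔₂-sym (Suffix∪Flip i)) (Suffix-isPO (toℕ<n i)) ,
    T-isPO-⊆ (inj₁ (IsPO.refl (Suffix-isPO (ℕ.<⇒≤ (toℕ<n i))) _)) (L-isPO (inject₁ i)) below
    where
    below : (Suffix (toℕ i) ∪ (Flip i ᵈ)) ⇒ ⟦ L (inject₁ i) ⟧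
    below (inj₁ s)                = Suffix-at i s
    below (inj₂ (inj₁ refl))      = IsPO.refl (L-isPO (inject₁ i)) _
    below (inj₂ (inj₂ (_ , ¬l))) = L-reverse (inject₁ i) ¬l

  Flip-conj : ∀ i → suc (toℕ i) ≡ m′ → Conj (Suffix (toℕ i)) (Flip i)
  Flip-conj i 1+i≡m′ x y x≢y = cover , λ (s , f) → Flip-disjoint i x≢y s f
    where
    ι = inject₁ i
    cover : Ordered (Suffix (toℕ i)) x y ⊎ Ordered (Flip i) x y
    cover with Suffix-last-total 1+i≡m′ x y | proj₂ (L-isLinear ι) x y
    ... | inj₁ sxy | inj₁ l = inj₁ (inj₁ (Suffix-extend i sxy l))
    ... | inj₂ syx | inj₂ l = inj₁ (inj₂ (Suffix-extend i syx l))
    ... | inj₁ sxy | inj₂ l = inj₂ (inj₁ (inj₂ (sxy , λ l′ → x≢y (IsPO.antisym (L-isPO ι) l′ l))))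
    ... | inj₂ syx | inj₁ l = inj₂ (inj₂ (inj₂ (syx , λ l′ → x≢y (IsPO.antisym (L-isPO ι) l l′))))

  Ps : Fin (suc m′) → BRel n
  Ps zero    = P
  Ps (suc i) = ⌊ Flip-dec i ⌋₂

  U : ℕ → SRel n
  U = UnionBelow Ps

  U⇔Suffix : ∀ a → a ≤ m′ → U (suc a) ⇔₂ Suffix a
  U⇔Suffix zero _ = ⇔₂-trans (UnionBelow-1 Ps) P⇔Suffix₀
  U⇔Suffix (suc a) 1+a≤m′ with U⇔Suffix a (ℕ.<⇒≤ 1+a≤m′) | toℕ-onto 1+a≤m′
  ... | U⇔Suffixₐ | i , refl =
    ⇔₂-trans (UnionBelow-suc Ps (suc i) refl)
      (⇔₂-trans (∪-cong U⇔Suffixₐ (⌊⌋₂-⇔ (Flip-dec i))) (Suffix∪Flip i))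

  U⇔Suffix-at : ∀ (i : Fin m′) → U (suc (toℕ i)) ⇔₂ Suffix (toℕ i)
  U⇔Suffix-at i = U⇔Suffix (toℕ i) (ℕ.<⇒≤ (toℕ<n i))

  allPO : ∀ i → IsPO ⟦ Ps i ⟧
  allPO zero    = isPO-resp (⇔₂-sym P⇔Suffix₀) (Suffix-isPO z≤n)
  allPO (suc i) = isPO-resp (⇔₂-sym (⌊⌋₂-⇔ (Flip-dec i))) (Flip-isPO i)

  middle : ∀ (j : Fin (suc m′)) → 1 ≤ toℕ j → toℕ j < m′ → PartialConj (U (toℕ j)) ⟦ Ps j ⟧
  middle (suc i) _ _ =
    PartialConj-resp (⇔₂-sym (U⇔Suffix-at i)) (⇔₂-sym (⌊⌋₂-⇔ (Flip-dec i))) (Flip-partialConj i)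

  last-at : ∀ (j : Fin (suc m′)) → toℕ j ≡ m′ → Conj (U (toℕ j)) ⟦ Ps j ⟧
  last-at zero refl x y x≢y = inj₂ total , λ { (inj₁ (_ , () , _) , _) ; (inj₂ (_ , () , _) , _) }
    where
    only : ∀ {u v} → ⟦ L zero ⟧ u v → ⟦ P ⟧ u v
    only {u} {v} l = Equivalence.from (P⇔⋂L u v) λ { zero → l }
    total : Ordered ⟦ P ⟧ x y
    total = Ordered-map only x y (proj₂ (L-isLinear zero) x y)
  last-at (suc i) 1+i≡m′ =
    Conj-resp (⇔₂-sym (U⇔Suffix-at i)) (⇔₂-sym (⌊⌋₂-⇔ (Flip-dec i))) (Flip-conj i 1+i≡m′)

  last : Conj (U m′) ⟦ Ps (fromℕ m′) ⟧
  last = subst (λ a → Conj (U a) ⟦ Ps (fromℕ m′) ⟧) (toℕ-fromℕ m′) (last-at (fromℕ m′) (toℕ-fromℕ m′))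

  sequence : RecSeq P m′
  sequence = record
    { Ps = Ps ; allPO = allPO ; first = λ _ _ → refl ; middle = middle ; last = last }

HasRealizer⇔HasSeq : ∀ {P : BRel n} k → HasRealizer P k ⇔ HasSeq P k
HasRealizer⇔HasSeq zero    = mk⇔ (λ { (() , _) }) (λ ())
HasRealizer⇔HasSeq (suc k) = mk⇔ (λ (_ , L , L-isLinear , P⇔⋂L) → FromRealizer.sequence L L-isLinear P⇔⋂L)
                                 FromSequence.realizer

theorem1 : (N : ℕ) (P : BRel (suc N)) → IsPO ⟦ P ⟧ →
    (∀ n → Dim P n ⇔ NFold P n)
    × (∀ n → Dim P n → Σ[ m ∈ ℕ ] (m ≤ n × HasSeq P m))
    × (∀ n → NFold P n → Σ[ k ∈ ℕ ] (k ≤ n × HasRealizer P k))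
theorem1 N P _ =
  (λ n → mk⇔ (λ (r , minimal) → toSeq n r , λ m s → minimal m (toRealizer m s))
             (λ (s , minimal) → toRealizer n s , λ k r → minimal k (toSeq k r))) ,
  (λ n (r , _) → n , ℕ.≤-refl , toSeq n r) ,
  (λ n (s , _) → n , ℕ.≤-refl , toRealizer n s)
  where
  toSeq : ∀ k → HasRealizer P k → HasSeq P k
  toSeq k = Equivalence.to (HasRealizer⇔HasSeq k)
  toRealizer : ∀ k → HasSeq P k → HasRealizer P k
  toRealizer k = Equivalence.from (HasRealizer⇔HasSeq k)
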